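{- Let $n>3$ be an integer such that $p=4n-1$ is prime, and define \begin{align*} A_{<}&=\{k\in\{2,\dots,n+2\}: r_p((k-1)^2)<3n-k-1\},\\ A_{[)}&=\{k\in\{2,\dots,n+2\}: 3n-k-1\le r_p((k-1)^2)<3n+k-3\},\\ A_{\ge}&=\{k\in\{2,\dots,n+2\}: r_p((k-1)^2)\ge 3n+k-3\},\\ B_{<}&=\{k\in\{n+3,\dots,2n\}: r_p((k-1)^2)<k-n-2\},\\ B_{[)}&=\{k\in\{n+3,\dots,2n\}: k-n-2\le r_p((k-1)^2)<3n-k-1\},\\ B_{\ge}&=\{k\in\{n+3,\dots,2n\}: r_p((k-1)^2)\ge 3n-k-1\}. \end{align*} Then $|B_{[)}|=\lfloor (n^2-4n+5)/p\rfloor$ and \[|A_{\ge}|=|B_{<}|,\qquad |A_{[)}|=|B_{[)}|+2,\qquad |A_{<}|=|B_{\ge}|+1.\]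
   Context: For a positive integer $q$ and $x\in\mathbb{Z}$, $r_q(x)\in\{0,1,\dots,q-1\}$ denotes the remainder of $x$ upon division by $q$. -}

module Defs where

open import Data.Nat using (ℕ; suc; _+_; _*_; _∸_; _<_; _≤_; _<?_; _≤?_)
open import Data.Nat.DivMod using (_%_; _/_)
open import Data.List using (List; upTo; map; filter; length)
open import Data.Product using (_×_)
open import Relation.Nullary using (Dec)
open import Relation.Nullary.Decidable using (_×-dec_)
open import Relation.Unary using (Pred; Decidable)
open import Level using (0ℓ)

range : ℕ → ℕ → List ℕ
range lo hi = map (lo +_) (upTo (suc hi ∸ lo))

count : ℕ → ℕ → {P : Pred ℕ 0ℓ} → Decidable P → ℕ
count lo hi P? = length (filter P? (range lo hi))

-- r_p(x) for x = (k-1)^2 ≥ 0, p = 4n-1 (n > 3 so p ≥ 15 ≠ 0): natural remainder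
-- p = 4n-1, written as suc (4n-2) so the NonZero instance is found (equal to 4n-1 for n ≥ 1)
p : ℕ → ℕ
p n = suc (4 * n ∸ 2)

r : ℕ → ℕ → ℕ
r n k = ((k ∸ 1) * (k ∸ 1)) % p n

-- predicates on k (all quantities are natural numbers for k in the given ranges)
A-lt : (n : ℕ) → Decidable (λ k → r n k < 3 * n ∸ k ∸ 1)
A-lt n k = r n k <? 3 * n ∸ k ∸ 1

A-mid : (n : ℕ) → Decidable (λ k → (3 * n ∸ k ∸ 1 ≤ r n k) × (r n k < 3 * n + k ∸ 3))
A-mid n k = (3 * n ∸ k ∸ 1 ≤? r n k) ×-dec (r n k <? 3 * n + k ∸ 3)

A-ge : (n : ℕ) → Decidable (λ k → 3 * n + k ∸ 3 ≤ r n k)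
A-ge n k = 3 * n + k ∸ 3 ≤? r n k

B-lt : (n : ℕ) → Decidable (λ k → r n k < k ∸ n ∸ 2)
B-lt n k = r n k <? k ∸ n ∸ 2

B-mid : (n : ℕ) → Decidable (λ k → (k ∸ n ∸ 2 ≤ r n k) × (r n k < 3 * n ∸ k ∸ 1))
B-mid n k = (k ∸ n ∸ 2 ≤? r n k) ×-dec (r n k <? 3 * n ∸ k ∸ 1)

B-ge : (n : ℕ) → Decidable (λ k → 3 * n ∸ k ∸ 1 ≤ r n k)
B-ge n k = 3 * n ∸ k ∸ 1 ≤? r n k

-- Write r(x) for the remainder of x modulo p. If c + d = p then ⌊(x + d)/p⌋ − ⌊x/p⌋ is 1 exactly
-- when r(x) ≥ c, so the indicator of r((k − 1)²) ∈ [c₁, c₂) is a difference of two such floors.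
-- Along A these floors are ⌊(a² + a + n + 1)/p⌋ with k = a + 2, along B they are
-- ⌊((2n + 1 − k)² + 1)/p⌋; both telescope, giving |A_[)| = ⌊(n² + 4n + 3)/p⌋ = ⌊(n² − 4n + 5)/p⌋ + 2
-- and |B_[)| = ⌊(n² − 4n + 5)/p⌋.
-- For 2 ≤ k < n the element k′ = 2n + 2 − k of B has (k′ − 1)² ≡ (k − 1)² + n + 1 − k (mod p), so
-- k ∈ A_≥ iff k′ ∈ B_<, unless p divides (k − 1)² + 1 or (k − 1)² + n + 2 − k, whose fourfold is
-- (2k − 3)² + 4 modulo p. Neither can happen since −1 and −4 are not squares modulo p ≡ 3 (mod 4); this also keeps
-- k = n, n + 1, n + 2 out of A_≥. The last identity follows from |A| = n + 1 and |B| = n − 2.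

module Submission where

open import Defs
open import Data.Nat using (ℕ; zero; suc; _+_; _*_; _∸_; _<_; _≤_; _<?_; _≤?_; z≤n; s≤s; NonZero; ≢-nonZero)
open import Data.Nat.Properties
open import Data.Nat.ListAction using (sum)
open import Data.List using ([]; _∷_; length; filter; map; applyUpTo; upTo)
open import Data.List.Properties using (map-∘; map-upTo)
open import Data.Product using (_×_; _,_; ∃-syntax)
open import Function using (_∘_)
open import Level using (0ℓ)
open import Relation.Nullary using (Dec; yes; no; ¬_; contradiction)
open import Relation.Nullary.Decidable using (_×-dec_)
open import Relation.Unary using (Pred; Decidable)
open import Relation.Binary.PropositionalEquality
open import Data.Nat.Tactic.RingSolver using (solve-∀)
open import Data.Nat.DivMod using (_/_; _%_; m≡m%n+[m/n]*n; m%n<n; m%n≤m; m<n⇒m/n≡0; m/n≡1+[m∸n]/n; m*n/n≡m; n/n≡1; +-distrib-/-∣ʳ; /-congˡ; %-distribˡ-+; %-distribˡ-*; [m+kn]%n≡m%n; m∣n⇒o%n%m≡o%m)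
open import Data.Nat.Divisibility using (_∣_; _∤_; divides; n∣m*n; n∣n; ∣-refl; ∣m∣n⇒∣m+n; m%n≡0⇒n∣m; n∣m⇒m%n≡0; ∣m+n∣m⇒∣n; ∣m⇒∣m*n; ∣n⇒∣m*n)
open import Data.Nat.Induction using (<-rec)
open import Data.Nat.Primality using (Prime)
open import Data.Sum using (_⊎_; inj₁; inj₂)
open import Data.Empty using (⊥)
open import Algebra.Properties.CommutativeSemigroup +-commutativeSemigroup using (interchange; x∙yz≈y∙xz; xy∙z≈y∙xz; xy∙z≈xz∙y)

𝟙 : {A : Set} → Dec A → ℕ
𝟙 (yes _) = 1
𝟙 (no _)  = 0

∑ : ℕ → (ℕ → ℕ) → ℕ
∑ m f = sum (applyUpTo f m)

syntax ∑ m (λ i → e) = ∑[ i < m ] e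

m≡o+n⇒m∸n≡o : ∀ {m n o} → m ≡ o + n → m ∸ n ≡ o
m≡o+n⇒m∸n≡o {n = n} {o} refl = m+n∸n≡m o n

m+n≡o+p∧p≤n⇒m≤o : ∀ {m n o p} → m + n ≡ o + p → p ≤ n → m ≤ o
m+n≡o+p∧p≤n⇒m≤o {m} {n} {o} {p} eq p≤n = +-cancelʳ-≤ n m o (subst (_≤ o + n) (sym eq) (+-monoʳ-≤ o p≤n))

module _ {P : Pred ℕ 0ℓ} (P? : Decidable P) where

  length-filter≡∑𝟙 : ∀ xs → length (filter P? xs) ≡ sum (map (𝟙 ∘ P?) xs)
  length-filter≡∑𝟙 []       = refl
  length-filter≡∑𝟙 (x ∷ xs) with P? x
  ... | yes _ = cong suc (length-filter≡∑𝟙 xs)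
  ... | no _  = length-filter≡∑𝟙 xs

  count≡∑ : ∀ lo hi → count lo hi P? ≡ ∑[ i < suc hi ∸ lo ] 𝟙 (P? (lo + i))
  count≡∑ lo hi = begin
    length (filter P? (map (lo +_) (upTo m)))  ≡⟨ length-filter≡∑𝟙 (map (lo +_) (upTo m)) ⟩
    sum (map (𝟙 ∘ P?) (map (lo +_) (upTo m)))  ≡⟨ cong sum (map-∘ (upTo m)) ⟨
    sum (map (𝟙 ∘ P? ∘ (lo +_)) (upTo m))      ≡⟨ cong sum (map-upTo _ m) ⟩
    ∑[ i < m ] 𝟙 (P? (lo + i))                 ∎
    where open ≡-Reasoning
          m = suc hi ∸ lo

∑-+ : ∀ m k (f : ℕ → ℕ) → ∑ (m + k) f ≡ ∑ m f + ∑[ i < k ] f (m + i)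
∑-+ zero    k f = refl
∑-+ (suc m) k f = trans (cong (f 0 +_) (∑-+ m k (f ∘ suc))) (sym (+-assoc (f 0) _ _))

∑-suc : ∀ m (f : ℕ → ℕ) → ∑ (suc m) f ≡ ∑ m f + f m
∑-suc zero    f = +-identityʳ (f 0)
∑-suc (suc m) f = trans (cong (f 0 +_) (∑-suc m (f ∘ suc))) (sym (+-assoc (f 0) _ _))

∑-reverse : ∀ m {f g : ℕ → ℕ} → (∀ i j → suc (i + j) ≡ m → f i ≡ g j) → ∑ m f ≡ ∑ m g
∑-reverse zero    f≡g = refl
∑-reverse (suc m) {f} {g} f≡g = begin
  f 0 + ∑ m (f ∘ suc)  ≡⟨ cong₂ _+_ (f≡g 0 m refl) (∑-reverse m (λ i j e → f≡g (suc i) j (cong suc e))) ⟩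
  g m + ∑ m g          ≡⟨ +-comm (g m) _ ⟩
  ∑ m g + g m          ≡⟨ ∑-suc m g ⟨
  ∑ (suc m) g          ∎
  where open ≡-Reasoning

∑-telescope-up : ∀ m {f F : ℕ → ℕ} → (∀ i j → suc (i + j) ≡ m → f i + F i ≡ F (suc i)) →
                 ∑ m f + F 0 ≡ F m
∑-telescope-up zero    step = refl
∑-telescope-up (suc m) {f} {F} step = begin
  f 0 + ∑ m (f ∘ suc) + F 0    ≡⟨ xy∙z≈y∙xz (f 0) (∑ m (f ∘ suc)) (F 0) ⟩
  ∑ m (f ∘ suc) + (f 0 + F 0)  ≡⟨ cong (∑ m (f ∘ suc) +_) (step 0 m refl) ⟩
  ∑ m (f ∘ suc) + F 1          ≡⟨ ∑-telescope-up m (λ i j e → step (suc i) j (cong suc e)) ⟩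
  F (suc m)                    ∎
  where open ≡-Reasoning

∑-telescope-down : ∀ m {f F : ℕ → ℕ} → (∀ i j → suc (i + j) ≡ m → f i + F (suc i) ≡ F i) →
                   ∑ m f + F m ≡ F 0
∑-telescope-down zero    step = refl
∑-telescope-down (suc m) {f} {F} step = begin
  f 0 + ∑ m (f ∘ suc) + F (suc m)    ≡⟨ +-assoc (f 0) _ _ ⟩
  f 0 + (∑ m (f ∘ suc) + F (suc m))  ≡⟨ cong (f 0 +_) (∑-telescope-down m (λ i j e → step (suc i) j (cong suc e))) ⟩
  f 0 + F 1                          ≡⟨ step 0 m refl ⟩
  F 0                                ∎
  where open ≡-Reasoning

∑-zero : ∀ m {f : ℕ → ℕ} → (∀ i j → suc (i + j) ≡ m → f i ≡ 0) → ∑ m f ≡ 0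
∑-zero m f≡0 = trans (sym (+-identityʳ _))
  (∑-telescope-up m {F = λ _ → 0} (λ i j e → trans (+-identityʳ _) (f≡0 i j e)))

∑-distrib-+ : ∀ m (f g : ℕ → ℕ) → ∑[ i < m ] (f i + g i) ≡ ∑ m f + ∑ m g
∑-distrib-+ zero    f g = refl
∑-distrib-+ (suc m) f g = trans (cong (f 0 + g 0 +_) (∑-distrib-+ m (f ∘ suc) (g ∘ suc)))
                                (interchange (f 0) (g 0) _ _)

∑-partition : ∀ m (f g h : ℕ → ℕ) → (∀ i j → suc (i + j) ≡ m → f i + g i + h i ≡ 1) →
              ∑ m f + ∑ m g + ∑ m h ≡ m
∑-partition m f g h one = begin
  ∑ m f + ∑ m g + ∑ m h               ≡⟨ cong (_+ ∑ m h) (∑-distrib-+ m f g) ⟨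
  ∑[ i < m ] (f i + g i) + ∑ m h      ≡⟨ ∑-distrib-+ m _ h ⟨
  ∑[ i < m ] (f i + g i + h i)        ≡⟨ +-identityʳ _ ⟨
  ∑[ i < m ] (f i + g i + h i) + 0    ≡⟨ ∑-telescope-up m {F = λ i → i} (λ i j e → cong (_+ i) (one i j e)) ⟩
  m                                   ∎
  where open ≡-Reasoning

module _ {A B : Set} where

  𝟙-cong : (A → B) → (B → A) → (a? : Dec A) (b? : Dec B) → 𝟙 a? ≡ 𝟙 b?
  𝟙-cong A→B B→A a? b? with a? | b?
  ... | yes _ | yes _ = refl
  ... | no _  | no _  = refl
  ... | yes a | no ¬b = contradiction (A→B a) ¬b
  ... | no ¬a | yes b = contradiction (B→A b) ¬a

𝟙-no : {A : Set} → ¬ A → (a? : Dec A) → 𝟙 a? ≡ 0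
𝟙-no ¬a (yes a) = contradiction a ¬a
𝟙-no ¬a (no _)  = refl

module _ {ρ : ℕ} where

  𝟙-<+𝟙-≥ : ∀ c → 𝟙 (ρ <? c) + 𝟙 (c ≤? ρ) ≡ 1
  𝟙-<+𝟙-≥ c with ρ <? c | c ≤? ρ
  ... | yes ρ<c | yes c≤ρ = contradiction c≤ρ (<⇒≱ ρ<c)
  ... | yes _   | no _    = refl
  ... | no _    | yes _   = refl
  ... | no ρ≮c  | no c≰ρ  = contradiction (≮⇒≥ ρ≮c) c≰ρ

  module _ {c₁ c₂ : ℕ} (c₁≤c₂ : c₁ ≤ c₂) where

    𝟙-between+𝟙-≥ : 𝟙 ((c₁ ≤? ρ) ×-dec (ρ <? c₂)) + 𝟙 (c₂ ≤? ρ) ≡ 𝟙 (c₁ ≤? ρ)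
    𝟙-between+𝟙-≥ with c₁ ≤? ρ | ρ <? c₂ | c₂ ≤? ρ
    ... | yes _    | yes ρ<c₂ | yes c₂≤ρ = contradiction c₂≤ρ (<⇒≱ ρ<c₂)
    ... | yes _    | yes _    | no _     = refl
    ... | yes _    | no _     | yes _    = refl
    ... | yes _    | no ρ≮c₂  | no c₂≰ρ  = contradiction (≮⇒≥ ρ≮c₂) c₂≰ρ
    ... | no c₁≰ρ  | _        | yes c₂≤ρ = contradiction (≤-trans c₁≤c₂ c₂≤ρ) c₁≰ρ
    ... | no _     | _        | no _     = refl

    𝟙-between+𝟙-< : 𝟙 ((c₁ ≤? ρ) ×-dec (ρ <? c₂)) + 𝟙 (ρ <? c₁) ≡ 𝟙 (ρ <? c₂)
    𝟙-between+𝟙-< with c₁ ≤? ρ | ρ <? c₂ | ρ <? c₁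
    ... | yes c₁≤ρ | _        | yes ρ<c₁ = contradiction c₁≤ρ (<⇒≱ ρ<c₁)
    ... | yes _    | yes _    | no _     = refl
    ... | yes _    | no _     | no _     = refl
    ... | no _     | yes _    | yes _    = refl
    ... | no _     | no ρ≮c₂  | yes ρ<c₁ = contradiction (<-≤-trans ρ<c₁ c₁≤c₂) ρ≮c₂
    ... | no c₁≰ρ  | _        | no ρ≮c₁  = contradiction (≮⇒≥ ρ≮c₁) c₁≰ρ

    𝟙-trichotomy : 𝟙 (ρ <? c₁) + 𝟙 ((c₁ ≤? ρ) ×-dec (ρ <? c₂)) + 𝟙 (c₂ ≤? ρ) ≡ 1
    𝟙-trichotomy = begin
      𝟙 (ρ <? c₁) + 𝟙 mid + 𝟙 (c₂ ≤? ρ)  ≡⟨ cong (_+ 𝟙 (c₂ ≤? ρ)) (+-comm (𝟙 (ρ <? c₁)) (𝟙 mid)) ⟩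
      𝟙 mid + 𝟙 (ρ <? c₁) + 𝟙 (c₂ ≤? ρ)  ≡⟨ cong (_+ 𝟙 (c₂ ≤? ρ)) 𝟙-between+𝟙-< ⟩
      𝟙 (ρ <? c₂) + 𝟙 (c₂ ≤? ρ)          ≡⟨ 𝟙-<+𝟙-≥ c₂ ⟩
      1                                  ∎
      where open ≡-Reasoning
            mid = (c₁ ≤? ρ) ×-dec (ρ <? c₂)

module _ {P : ℕ} .{{_ : NonZero P}} where

  [ρ+d]/P≡𝟙 : ∀ {ρ d} → ρ < P → d ≤ P → (ρ + d) / P ≡ 𝟙 (P ≤? ρ + d)
  [ρ+d]/P≡𝟙 {ρ} {d} ρ<P d≤P with P ≤? ρ + d
  ... | no  P≰ρ+d = m<n⇒m/n≡0 (≰⇒> P≰ρ+d)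
  ... | yes P≤ρ+d = trans (m/n≡1+[m∸n]/n P≤ρ+d)
                          (cong suc (m<n⇒m/n≡0 (m<n+o⇒m∸n<o (ρ + d) P (+-mono-<-≤ ρ<P d≤P))))

  /-+-overflow : ∀ x {d} → d ≤ P → (x + d) / P ≡ x / P + 𝟙 (P ≤? x % P + d)
  /-+-overflow x {d} d≤P = begin
    (x + d) / P                      ≡⟨ /-congˡ (cong (_+ d) (m≡m%n+[m/n]*n x P)) ⟩
    (x % P + x / P * P + d) / P      ≡⟨ /-congˡ (xy∙z≈xz∙y (x % P) _ d) ⟩
    (x % P + d + x / P * P) / P      ≡⟨ +-distrib-/-∣ʳ (x % P + d) (n∣m*n (x / P)) ⟩
    (x % P + d) / P + x / P * P / P  ≡⟨ cong₂ _+_ ([ρ+d]/P≡𝟙 (m%n<n x P) d≤P) (m*n/n≡m (x / P) P) ⟩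
    𝟙 (P ≤? x % P + d) + x / P       ≡⟨ +-comm _ (x / P) ⟩
    x / P + 𝟙 (P ≤? x % P + d)       ∎
    where open ≡-Reasoning

  /-+-carry : ∀ x {c d} → c + d ≡ P → (x + d) / P ≡ x / P + 𝟙 (c ≤? x % P)
  /-+-carry x {c} {d} c+d≡P =
    trans (/-+-overflow x (subst (d ≤_) c+d≡P (m≤n+m d c))) (cong (x / P +_) (𝟙-cong P≤ρ+d⇒c≤ρ c≤ρ⇒P≤ρ+d _ _))
    where
    P≤ρ+d⇒c≤ρ : P ≤ x % P + d → c ≤ x % P
    P≤ρ+d⇒c≤ρ le = +-cancelʳ-≤ d c (x % P) (subst (_≤ x % P + d) (sym c+d≡P) le)
    c≤ρ⇒P≤ρ+d : c ≤ x % P → P ≤ x % P + d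
    c≤ρ⇒P≤ρ+d le = subst (_≤ x % P + d) c+d≡P (+-monoˡ-≤ d le)

  -- Adding P ∸ s to M = x + s adds exactly P to x, and it carries iff M % P ≥ s.
  /-+-borrow : ∀ {M x s} → M ≡ x + s → s ≤ P → M / P ≡ x / P + 𝟙 (M % P <? s)
  /-+-borrow {M} {x} {s} refl s≤P = +-cancelʳ-≡ (𝟙 (s ≤? ρ)) _ _ (begin
    M / P + 𝟙 (s ≤? ρ)                  ≡⟨ /-+-carry M (m+[n∸m]≡n s≤P) ⟨
    (M + (P ∸ s)) / P                   ≡⟨ /-congˡ (trans (+-assoc x s _) (cong (x +_) (m+[n∸m]≡n s≤P))) ⟩
    (x + P) / P                         ≡⟨ +-distrib-/-∣ʳ x n∣n ⟩
    x / P + P / P                       ≡⟨ cong (x / P +_) (trans (n/n≡1 P) (sym (𝟙-<+𝟙-≥ s))) ⟩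
    x / P + (𝟙 (ρ <? s) + 𝟙 (s ≤? ρ))   ≡⟨ +-assoc (x / P) _ _ ⟨
    x / P + 𝟙 (ρ <? s) + 𝟙 (s ≤? ρ)     ∎)
    where open ≡-Reasoning
          ρ = M % P

  [m+kP]/P≡m/P+k : ∀ x k → (x + k * P) / P ≡ x / P + k
  [m+kP]/P≡m/P+k x k = trans (+-distrib-/-∣ʳ x (n∣m*n k)) (cong (x / P +_) (m*n/n≡m k P))

  ∤m+n⇒∤m+kP+n : ∀ {x e} k → P ∤ x + e → P ∤ x + k * P + e
  ∤m+n⇒∤m+kP+n {x} {e} k P∤x+e P∣ = P∤x+e (∣m+n∣m⇒∣n (subst (P ∣_) (trans (xy∙z≈xz∙y x _ e) (+-comm (x + e) _)) P∣) (n∣m*n k))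

  m%P+n≡P⇒P∣m+n : ∀ {x e} → x % P + e ≡ P → P ∣ x + e
  m%P+n≡P⇒P∣m+n {x} {e} eq = divides (suc (x / P)) (begin
    x + e                  ≡⟨ cong (_+ e) (m≡m%n+[m/n]*n x P) ⟩
    x % P + x / P * P + e  ≡⟨ xy∙z≈xz∙y (x % P) _ e ⟩
    x % P + e + x / P * P  ≡⟨ cong (_+ x / P * P) eq ⟩
    P + x / P * P          ∎)
    where open ≡-Reasoning

  [m+n]%P≡n⇒P∣m : ∀ {x s} → (x + s) % P ≡ s → P ∣ x
  [m+n]%P≡n⇒P∣m {x} {s} eq = divides ((x + s) / P) (+-cancelʳ-≡ s x _ (begin
    x + s                          ≡⟨ m≡m%n+[m/n]*n (x + s) P ⟩
    (x + s) % P + (x + s) / P * P  ≡⟨ cong (_+ (x + s) / P * P) eq ⟩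
    s + (x + s) / P * P            ≡⟨ +-comm s _ ⟩
    (x + s) / P * P + s            ∎))
    where open ≡-Reasoning

  𝟙-between-carry : ∀ x {c₁ c₂ d₁ d₂} → c₁ + d₁ ≡ P → c₂ + d₂ ≡ P → d₂ ≤ d₁ →
                    𝟙 ((c₁ ≤? x % P) ×-dec (x % P <? c₂)) + (x + d₂) / P ≡ (x + d₁) / P
  𝟙-between-carry x {c₁} {c₂} {d₁} {d₂} c₁+d₁≡P c₂+d₂≡P d₂≤d₁ = begin
    𝟙 mid + (x + d₂) / P                ≡⟨ cong (𝟙 mid +_) (/-+-carry x c₂+d₂≡P) ⟩
    𝟙 mid + (x / P + 𝟙 (c₂ ≤? x % P))   ≡⟨ x∙yz≈y∙xz (𝟙 mid) (x / P) _ ⟩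
    x / P + (𝟙 mid + 𝟙 (c₂ ≤? x % P))   ≡⟨ cong (x / P +_) (𝟙-between+𝟙-≥ c₁≤c₂) ⟩
    x / P + 𝟙 (c₁ ≤? x % P)             ≡⟨ /-+-carry x c₁+d₁≡P ⟨
    (x + d₁) / P                        ∎
    where
    open ≡-Reasoning
    mid = (c₁ ≤? x % P) ×-dec (x % P <? c₂)
    c₁≤c₂ = m+n≡o+p∧p≤n⇒m≤o (trans c₁+d₁≡P (sym c₂+d₂≡P)) d₂≤d₁

  𝟙-between-borrow : ∀ {M x y s c} → M ≡ x + s → M ≡ y + c → s ≤ c → c ≤ P →
                     𝟙 ((s ≤? M % P) ×-dec (M % P <? c)) + y / P ≡ x / P
  𝟙-between-borrow {M} {x} {y} {s} {c} M≡x+s M≡y+c s≤c c≤P = +-cancelʳ-≡ (𝟙 (ρ <? s)) _ _ (begin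
    𝟙 mid + y / P + 𝟙 (ρ <? s)   ≡⟨ xy∙z≈xz∙y (𝟙 mid) _ _ ⟩
    𝟙 mid + 𝟙 (ρ <? s) + y / P   ≡⟨ cong (_+ y / P) (𝟙-between+𝟙-< s≤c) ⟩
    𝟙 (ρ <? c) + y / P           ≡⟨ +-comm _ (y / P) ⟩
    y / P + 𝟙 (ρ <? c)           ≡⟨ /-+-borrow M≡y+c c≤P ⟨
    M / P                        ≡⟨ /-+-borrow M≡x+s (≤-trans s≤c c≤P) ⟩
    x / P + 𝟙 (ρ <? s)           ∎)
    where open ≡-Reasoning
          ρ = M % P
          mid = (s ≤? ρ) ×-dec (ρ <? c)

  𝟙-≥-shift : ∀ {M x c s} → c + suc (suc s) ≡ P → M ≡ x + suc s → P ∤ x + 1 → P ∤ x + suc (suc s) →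
              𝟙 (c ≤? x % P) ≡ 𝟙 (M % P <? s)
  𝟙-≥-shift {M} {x} {c} {s} c+2+s≡P refl P∤x+1 P∤x+2+s = begin
    𝟙 (c ≤? ρ)          ≡⟨ 𝟙-cong (λ c≤ρ → ≤∧≢⇒< c≤ρ c≢ρ) <⇒≤ _ _ ⟩
    𝟙 (suc c ≤? ρ)      ≡⟨ +-cancelˡ-≡ (x / P) _ _ (trans (sym (/-+-carry x 1+c+1+s≡P)) (/-+-borrow refl 1+s≤P)) ⟩
    𝟙 (ρ′ <? suc s)     ≡⟨ 𝟙-cong (λ ρ′≤s → ≤∧≢⇒< (≤-pred ρ′≤s) ρ′≢s) m<n⇒m<1+n _ _ ⟩
    𝟙 (ρ′ <? s)         ∎
    where
    open ≡-Reasoning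
    ρ = x % P
    ρ′ = M % P
    1+c+1+s≡P : suc c + suc s ≡ P
    1+c+1+s≡P = trans (sym (+-suc c (suc s))) c+2+s≡P
    1+s≤P : suc s ≤ P
    1+s≤P = subst (suc s ≤_) c+2+s≡P (≤-trans (n≤1+n (suc s)) (m≤n+m _ c))
    c≢ρ : c ≢ ρ
    c≢ρ c≡ρ = P∤x+2+s (m%P+n≡P⇒P∣m+n (subst (λ z → z + suc (suc s) ≡ P) c≡ρ c+2+s≡P))
    ρ′≢s : ρ′ ≢ s
    ρ′≢s ρ′≡s = P∤x+1 ([m+n]%P≡n⇒P∣m (trans (cong (_% P) (+-assoc x 1 s)) ρ′≡s))

  𝟙-≥-top : ∀ {x c b} → c + b ≡ P → b ≤ 2 → P ∤ x + 1 → P ∤ x + b → 𝟙 (c ≤? x % P) ≡ 0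
  𝟙-≥-top {x} {c} {b} c+b≡P b≤2 P∤x+1 P∤x+b = 𝟙-no c≰ρ _
    where
    ρ = x % P
    c≰ρ : ¬ c ≤ ρ
    c≰ρ c≤ρ with m≤n⇒m<n∨m≡n c≤ρ
    ... | inj₂ c≡ρ = P∤x+b (m%P+n≡P⇒P∣m+n (subst (λ z → z + b ≡ P) c≡ρ c+b≡P))
    ... | inj₁ c<ρ = P∤x+1 (m%P+n≡P⇒P∣m+n (≤-antisym (subst (_≤ P) (+-comm 1 ρ) (m%n<n x P)) P≤r+1))
      where
      P≤r+1 : P ≤ ρ + 1
      P≤r+1 = begin
        P          ≡⟨ c+b≡P ⟨
        c + b      ≤⟨ +-monoʳ-≤ c b≤2 ⟩
        c + 2      ≡⟨ +-suc c 1 ⟩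
        suc c + 1  ≤⟨ +-monoˡ-≤ 1 c<ρ ⟩
        ρ + 1      ∎
        where open ≤-Reasoning

%2≡0⊎%2≡1 : ∀ n → n % 2 ≡ 0 ⊎ n % 2 ≡ 1
%2≡0⊎%2≡1 n with n % 2 | m%n<n n 2
... | 0           | _                   = inj₁ refl
... | 1           | _                   = inj₂ refl
... | suc (suc _) | s≤s (s≤s ())

n%2≡0⇒n≡[n/2]*2 : ∀ {n} → n % 2 ≡ 0 → n ≡ n / 2 * 2
n%2≡0⇒n≡[n/2]*2 {n} eq = trans (m≡m%n+[m/n]*n n 2) (cong (_+ n / 2 * 2) eq)

∣x²+e⇒∣y²+e : ∀ {x y e} → x + y ∣ x * x + e → x + y ∣ y * y + e
∣x²+e⇒∣y²+e {x} {y} {e} d = ∣m+n∣m⇒∣n (subst (x + y ∣_) (identity x y e) (∣m∣n+ d)) (∣n⇒∣m*n (2 * x) ∣-refl)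
  where
  identity : ∀ x y e → (x + y) * (x + y) + (x * x + e) ≡ 2 * x * (x + y) + (y * y + e)
  identity = solve-∀
  ∣m∣n+ : x + y ∣ x * x + e → x + y ∣ (x + y) * (x + y) + (x * x + e)
  ∣m∣n+ = ∣m∣n⇒∣m+n (∣m⇒∣m*n (x + y) ∣-refl)

module _ {m : ℕ} .{{_ : NonZero m}} where

  ∣x²+e⇒∣[x%m]²+e : ∀ {x e} → m ∣ x * x + e → m ∣ x % m * (x % m) + e
  ∣x²+e⇒∣[x%m]²+e {x} {e} m∣ = m%n≡0⇒n∣m _ m (begin
    (x % m * (x % m) + e) % m          ≡⟨ %-distribˡ-+ (x % m * (x % m)) e m ⟩
    (x % m * (x % m) % m + e % m) % m  ≡⟨ cong (λ z → (z + e % m) % m) (%-distribˡ-* x x m) ⟨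
    (x * x % m + e % m) % m            ≡⟨ %-distribˡ-+ (x * x) e m ⟨
    (x * x + e) % m                    ≡⟨ n∣m⇒m%n≡0 _ m m∣ ⟩
    0                                  ∎)
    where open ≡-Reasoning

  -- For odd m, one of x % m and m ∸ x % m is even.
  even-root : ∀ {x e} → m % 2 ≡ 1 → m ∣ x * x + e → ∃[ h ] h * 2 < m × m ∣ h * 2 * (h * 2) + e
  even-root {x} {e} m-odd m∣ with %2≡0⊎%2≡1 (x % m)
  ... | inj₁ x₀-even = x₀ / 2 , subst (_< m) x₀≡ (m%n<n x m)
                              , subst (λ z → m ∣ z * z + e) x₀≡ (∣x²+e⇒∣[x%m]²+e m∣)
    where x₀ = x % m
          x₀≡ = n%2≡0⇒n≡[n/2]*2 x₀-even
  ... | inj₂ x₀-odd = y / 2 , subst (_< m) y≡ y<m , subst (λ z → m ∣ z * z + e) y≡ m∣y²+e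
    where
    x₀ = x % m
    y = m ∸ x₀
    x₀+y≡m : x₀ + y ≡ m
    x₀+y≡m = m+[n∸m]≡n (<⇒≤ (m%n<n x m))
    m∣y²+e : m ∣ y * y + e
    m∣y²+e = subst (λ z → z ∣ y * y + e) x₀+y≡m
               (∣x²+e⇒∣y²+e {x₀} {y} (subst (λ z → z ∣ x₀ * x₀ + e) (sym x₀+y≡m) (∣x²+e⇒∣[x%m]²+e m∣)))
    y<m : y < m
    y<m = ∸-monoʳ-< (≤∧≢⇒< z≤n (λ 0≡x₀ → 0≢1+n (trans (cong (_% 2) 0≡x₀) x₀-odd))) (<⇒≤ (m%n<n x m))
    y≡ : y ≡ y / 2 * 2
    y≡ with %2≡0⊎%2≡1 y
    ... | inj₁ y-even = n%2≡0⇒n≡[n/2]*2 y-even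
    ... | inj₂ y-odd  = contradiction (trans (sym m-even) m-odd) 0≢1+n
      where
      m-even : m % 2 ≡ 0
      m-even = begin
        m % 2                      ≡⟨ cong (_% 2) x₀+y≡m ⟨
        (x₀ + y) % 2               ≡⟨ %-distribˡ-+ x₀ y 2 ⟩
        (x₀ % 2 + y % 2) % 2       ≡⟨ cong₂ (λ a b → (a + b) % 2) x₀-odd y-odd ⟩
        0                          ∎
        where open ≡-Reasoning

x*x+1<y*y : ∀ {x y} → 2 ≤ y → x < y → x * x + 1 < y * y
x*x+1<y*y {zero}  2≤y _   = ≤-trans (s≤s (s≤s z≤n)) (*-mono-≤ 2≤y 2≤y)
x*x+1<y*y {suc x} _   x<y = <-≤-trans [1+x]²+1<[2+x]² (*-mono-≤ x<y x<y)
  where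
  identity : ∀ x → suc (suc x) * suc (suc x) ≡ suc (suc x * suc x + 1) + (2 * x + 1)
  identity = solve-∀
  [1+x]²+1<[2+x]² : suc x * suc x + 1 < suc (suc x) * suc (suc x)
  [1+x]²+1<[2+x]² = subst (suc (suc x * suc x + 1) ≤_) (sym (identity x)) (m≤m+n _ (2 * x + 1))

residue*3≡1⇒residue≡3 : ∀ ρ → ρ < 4 → ρ * 3 % 4 ≡ 1 → ρ ≡ 3
residue*3≡1⇒residue≡3 0 _ ()
residue*3≡1⇒residue≡3 1 _ ()
residue*3≡1⇒residue≡3 2 _ ()
residue*3≡1⇒residue≡3 3 _ _ = refl
residue*3≡1⇒residue≡3 (suc (suc (suc (suc _)))) (s≤s (s≤s (s≤s (s≤s ())))) _

m%4≡3⇒NonZero : ∀ {m} → m % 4 ≡ 3 → NonZero m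
m%4≡3⇒NonZero {m} m%4≡3 = ≢-nonZero (λ m≡0 → contradiction (trans (cong (_% 4) (sym m≡0)) m%4≡3) λ ())

module _ {m : ℕ} .{{_ : NonZero m}} where

  -- An even root y < m of -1 gives y² + 1 = c m with c ≡ 3 (mod 4) and c < m.
  smaller-divisor : ∀ {x} → m % 4 ≡ 3 → m ∣ x * x + 1 → ∃[ c ] c < m × c % 4 ≡ 3 × ∃[ y ] c ∣ y * y + 1
  smaller-divisor {x} m%4≡3 m∣x²+1 with even-root {x = x} m%2≡1 m∣x²+1
    where m%2≡1 = trans (sym (m∣n⇒o%n%m≡o%m 2 4 m (divides 2 refl))) (cong (_% 2) m%4≡3)
  ... | h , y<m , divides c y²+1≡c*m = c , c<m , c%4≡3 , y , divides m (trans y²+1≡c*m (*-comm c m))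
    where
    y = h * 2
    c%4≡3 : c % 4 ≡ 3
    c%4≡3 = residue*3≡1⇒residue≡3 (c % 4) (m%n<n c 4) (begin
      c % 4 * 3 % 4         ≡⟨ cong (λ z → c % 4 * z % 4) m%4≡3 ⟨
      c % 4 * (m % 4) % 4   ≡⟨ %-distribˡ-* c m 4 ⟨
      c * m % 4             ≡⟨ cong (_% 4) y²+1≡c*m ⟨
      (y * y + 1) % 4       ≡⟨ cong (_% 4) (identity h) ⟩
      (1 + h * h * 4) % 4   ≡⟨ [m+kn]%n≡m%n 1 (h * h) 4 ⟩
      1                     ∎)
      where open ≡-Reasoning
            identity : ∀ h → h * 2 * (h * 2) + 1 ≡ 1 + h * h * 4
            identity = solve-∀
    c<m : c < m
    c<m = *-cancelʳ-< m c m (subst (_< m * m) y²+1≡c*m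
            (x*x+1<y*y (≤-trans (s≤s (s≤s z≤n)) (subst (_≤ m) m%4≡3 (m%n≤m m 4))) y<m))

m%4≡3⇒m∤x²+1 : ∀ m → m % 4 ≡ 3 → ∀ x → m ∤ x * x + 1
m%4≡3⇒m∤x²+1 = <-rec (λ m → m % 4 ≡ 3 → ∀ x → m ∤ x * x + 1) descent
  where
  descent : ∀ m → (∀ {c} → c < m → c % 4 ≡ 3 → ∀ x → c ∤ x * x + 1) → m % 4 ≡ 3 → ∀ x → m ∤ x * x + 1
  descent m ih m%4≡3 x m∣x²+1 = contradict (smaller-divisor {m} {{m%4≡3⇒NonZero m%4≡3}} {x} m%4≡3 m∣x²+1)
    where
    contradict : ∃[ c ] c < m × c % 4 ≡ 3 × ∃[ y ] c ∣ y * y + 1 → ⊥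
    contradict (c , c<m , c%4≡3 , y , c∣y²+1) = ih c<m c%4≡3 y c∣y²+1

-- If 2z = m + 1 then z x is a root of -1 modulo m whenever x is a root of -4.
m%4≡3⇒m∤x²+4 : ∀ m → m % 4 ≡ 3 → ∀ x → m ∤ x * x + 4
m%4≡3⇒m∤x²+4 m m%4≡3 x m∣x²+4 = m%4≡3⇒m∤x²+1 m m%4≡3 (z * x)
  (∣m+n∣m⇒∣n (subst (m ∣_) (sym identity) (∣n⇒∣m*n (z * z) m∣x²+4)) (∣m⇒∣m*n (m + 2) ∣-refl))
  where
  q = m / 4
  z = 2 + q * 2
  m≡3+q*4 : m ≡ 3 + q * 4
  m≡3+q*4 = trans (m≡m%n+[m/n]*n m 4) (cong (_+ q * 4) m%4≡3)
  identity : m * (m + 2) + (z * x * (z * x) + 1) ≡ z * z * (x * x + 4)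
  identity = subst (λ k → k * (k + 2) + (z * x * (z * x) + 1) ≡ z * z * (x * x + 4)) (sym m≡3+q*4) (expand q x)
    where expand : ∀ q x → (3 + q * 4) * (3 + q * 4 + 2) + ((2 + q * 2) * x * ((2 + q * 2) * x) + 1)
                           ≡ (2 + q * 2) * (2 + q * 2) * (x * x + 4)
          expand = solve-∀

missing-summand : ∀ {a₁ a₂ a₃ b₁ b₂ b₃ m} → a₁ + a₂ + a₃ ≡ 3 + m → b₁ + b₂ + b₃ ≡ m →
                  a₂ ≡ b₂ + 2 → a₃ ≡ b₁ → a₁ ≡ b₃ + 1
missing-summand {a₁} {b₁ = b₁} {b₂} {b₃} sumA refl refl refl =
  +-cancelʳ-≡ (b₂ + 2 + b₁) a₁ (b₃ + 1) (trans (sym (+-assoc a₁ _ b₁)) (trans sumA (regroup b₁ b₂ b₃)))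
  where regroup : ∀ b₁ b₂ b₃ → 3 + (b₁ + b₂ + b₃) ≡ b₃ + 1 + (b₂ + 2 + b₁)
        regroup = solve-∀

module Counting (n₁ : ℕ) where

  n : ℕ
  n = 3 + n₁

  P : ℕ
  P = p n

  P≡11+n₁*4 : P ≡ 11 + n₁ * 4
  P≡11+n₁*4 = cong suc (m≡o+n⇒m∸n≡o (expand n₁))
    where expand : ∀ n₁ → 4 * (3 + n₁) ≡ 10 + n₁ * 4 + 2
          expand = solve-∀

  4n≡P+1 : 4 * n ≡ P + 1
  4n≡P+1 = trans (expand n₁) (cong (_+ 1) (sym P≡11+n₁*4))
    where expand : ∀ n₁ → 4 * (3 + n₁) ≡ 11 + n₁ * 4 + 1
          expand = solve-∀

  P%4≡3 : P % 4 ≡ 3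
  P%4≡3 = trans (cong (_% 4) P≡11+n₁*4) ([m+kn]%n≡m%n 3 (2 + n₁) 4)

  P∤x²+1 : ∀ x → P ∤ x * x + 1
  P∤x²+1 = m%4≡3⇒m∤x²+1 P P%4≡3

  -- 4 ((1 + a)² + b) ≡ (1 + 2a)² + 4 (mod P) because 4 (a + b) = 4 n ≡ 1.
  P∤[1+a]²+b : ∀ {a b} → a + b ≡ n → P ∤ suc a * suc a + b
  P∤[1+a]²+b {a} {b} a+b≡n P∣ = m%4≡3⇒m∤x²+4 P P%4≡3 y
      (∣m+n∣m⇒∣n (subst (P ∣_) four-times (∣n⇒∣m*n 4 P∣)) ∣-refl)
    where
    y = 1 + a * 2
    four-times : 4 * (suc a * suc a + b) ≡ P + (y * y + 4)
    four-times = +-cancelʳ-≡ 1 _ _ (begin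
      4 * (suc a * suc a + b) + 1  ≡⟨ expand a b ⟩
      y * y + 4 + 4 * (a + b)      ≡⟨ cong (λ z → y * y + 4 + 4 * z) a+b≡n ⟩
      y * y + 4 + 4 * n            ≡⟨ cong (y * y + 4 +_) 4n≡P+1 ⟩
      y * y + 4 + (P + 1)          ≡⟨ +-assoc (y * y + 4) P 1 ⟨
      y * y + 4 + P + 1            ≡⟨ cong (_+ 1) (+-comm (y * y + 4) P) ⟩
      P + (y * y + 4) + 1          ∎)
      where open ≡-Reasoning
            expand : ∀ a b → 4 * (suc a * suc a + b) + 1 ≡ (1 + a * 2) * (1 + a * 2) + 4 + 4 * (a + b)
            expand = solve-∀

  A-lower+ : ∀ {a u} → a + u ≡ n → 3 * n ∸ (2 + a) ∸ 1 + (a + n + 2) ≡ P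
  A-lower+ {a} {u} a+u≡n = begin
    3 * n ∸ (2 + a) ∸ 1 + (a + n + 2)  ≡⟨ cong (_+ (a + n + 2)) lower≡ ⟩
    2 * n₁ + 3 + u + (a + n + 2)       ≡⟨ regroup n₁ a u ⟩
    3 * n₁ + 8 + (a + u)               ≡⟨ cong (3 * n₁ + 8 +_) a+u≡n ⟩
    3 * n₁ + 8 + n                     ≡⟨ expand n₁ ⟩
    11 + n₁ * 4                        ≡⟨ P≡11+n₁*4 ⟨
    P                                  ∎
    where
    open ≡-Reasoning
    regroup : ∀ n₁ a u → 2 * n₁ + 3 + u + (a + (3 + n₁) + 2) ≡ 3 * n₁ + 8 + (a + u)
    regroup = solve-∀
    expand : ∀ n₁ → 3 * n₁ + 8 + (3 + n₁) ≡ 11 + n₁ * 4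
    expand = solve-∀
    lower≡ : 3 * n ∸ (2 + a) ∸ 1 ≡ 2 * n₁ + 3 + u
    lower≡ = trans (cong (_∸ 1) (m≡o+n⇒m∸n≡o {n = 2 + a} 3n≡)) (m+n∸n≡m _ 1)
      where
      3n≡ : 3 * n ≡ 2 * n₁ + 3 + u + 1 + (2 + a)
      3n≡ = trans (e₁ n₁) (trans (cong (2 * n₁ + 6 +_) (sym a+u≡n)) (e₂ n₁ a u))
        where e₁ : ∀ n₁ → 3 * (3 + n₁) ≡ 2 * n₁ + 6 + (3 + n₁)
              e₁ = solve-∀
              e₂ : ∀ n₁ a u → 2 * n₁ + 6 + (a + u) ≡ 2 * n₁ + 3 + u + 1 + (2 + a)
              e₂ = solve-∀

  A-upper+ : ∀ {a u} → a + u ≡ n → 3 * n + (2 + a) ∸ 3 + u ≡ P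
  A-upper+ {a} {u} a+u≡n = begin
    3 * n + (2 + a) ∸ 3 + u  ≡⟨ cong (_+ u) (m≡o+n⇒m∸n≡o (e₁ n₁ a)) ⟩
    3 * n₁ + 8 + a + u       ≡⟨ +-assoc (3 * n₁ + 8) a u ⟩
    3 * n₁ + 8 + (a + u)     ≡⟨ cong (3 * n₁ + 8 +_) a+u≡n ⟩
    3 * n₁ + 8 + n           ≡⟨ e₂ n₁ ⟩
    11 + n₁ * 4              ≡⟨ P≡11+n₁*4 ⟨
    P                        ∎
    where
    open ≡-Reasoning
    e₁ : ∀ n₁ a → 3 * (3 + n₁) + (2 + a) ≡ 3 * n₁ + 8 + a + 3
    e₁ = solve-∀
    e₂ : ∀ n₁ → 3 * n₁ + 8 + (3 + n₁) ≡ 11 + n₁ * 4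
    e₂ = solve-∀

  u≤a+n+2 : ∀ {a u} → a + u ≡ n → u ≤ a + n + 2
  u≤a+n+2 {a} {u} a+u≡n = ≤-trans (subst (u ≤_) a+u≡n (m≤n+m u a)) (≤-trans (m≤n+m n a) (m≤m+n (a + n) 2))

  A-floor : ℕ → ℕ
  A-floor a = (a * a + a + n + 1) / P

  A-mid-step : ∀ {a u} → a + u ≡ n → 𝟙 (A-mid n (2 + a)) + A-floor a ≡ A-floor (suc a)
  A-mid-step {a} {u} a+u≡n = begin
    𝟙 (A-mid n (2 + a)) + A-floor a                ≡⟨ cong (λ z → 𝟙 (A-mid n (2 + a)) + z / P) A-floor-arg ⟩
    𝟙 (A-mid n (2 + a)) + (suc a * suc a + u) / P  ≡⟨ 𝟙-between-carry (suc a * suc a) (A-lower+ {a} a+u≡n)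
                                                                         (A-upper+ {a} a+u≡n) (u≤a+n+2 {a} a+u≡n) ⟩
    (suc a * suc a + (a + n + 2)) / P              ≡⟨ cong (_/ P) (expand a n) ⟨
    A-floor (suc a)                                ∎
    where
    open ≡-Reasoning
    A-floor-arg : a * a + a + n + 1 ≡ suc a * suc a + u
    A-floor-arg = trans (cong (λ z → a * a + a + z + 1) (sym a+u≡n)) (e a u)
      where e : ∀ a u → a * a + a + (a + u) + 1 ≡ suc a * suc a + u
            e = solve-∀
    expand : ∀ a n → suc a * suc a + suc a + n + 1 ≡ suc a * suc a + (a + n + 2)
    expand = solve-∀

  A-trichotomy : ∀ {a u} → a + u ≡ n → 𝟙 (A-lt n (2 + a)) + 𝟙 (A-mid n (2 + a)) + 𝟙 (A-ge n (2 + a)) ≡ 1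
  A-trichotomy {a} a+u≡n = 𝟙-trichotomy {ρ = suc a * suc a % P} {3 * n ∸ (2 + a) ∸ 1} {3 * n + (2 + a) ∸ 3}
    (m+n≡o+p∧p≤n⇒m≤o (trans (A-lower+ {a} a+u≡n) (sym (A-upper+ {a} a+u≡n))) (u≤a+n+2 {a} a+u≡n))

  A-ge-top : ∀ {a b} → a + b ≡ n → b ≤ 2 → 𝟙 (A-ge n (2 + a)) ≡ 0
  A-ge-top {a} a+b≡n b≤2 = 𝟙-≥-top (A-upper+ {a} a+b≡n) b≤2 (P∤x²+1 (suc a)) (P∤[1+a]²+b {a} a+b≡n)

  k∸n∸2≡ : ∀ t → n + 3 + t ∸ n ∸ 2 ≡ suc t
  k∸n∸2≡ t = cong (_∸ 2) (trans (cong (_∸ n) (+-assoc n 3 t)) (m+n∸m≡n n (3 + t)))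

  k∸1≡ : ∀ t → n + 3 + t ∸ 1 ≡ n + 2 + t
  k∸1≡ t = m≡o+n⇒m∸n≡o (e n t)
    where e : ∀ n t → n + 3 + t ≡ n + 2 + t + 1
          e = solve-∀

  3n∸k∸1≡ : ∀ t j → n₁ ≡ t + j → 3 * n ∸ (n + 3 + t) ∸ 1 ≡ 2 * j + t + 2
  3n∸k∸1≡ t j refl = trans (cong (_∸ 1) (m≡o+n⇒m∸n≡o {n = n + 3 + t} (e t j))) (m+n∸n≡m _ 1)
    where e : ∀ t j → 3 * (3 + (t + j)) ≡ 2 * j + t + 2 + 1 + (3 + (t + j) + 3 + t)
          e = solve-∀

  B-lower≤B-upper : ∀ t j → n₁ ≡ t + j → n + 3 + t ∸ n ∸ 2 ≤ 3 * n ∸ (n + 3 + t) ∸ 1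
  B-lower≤B-upper t j n₁≡t+j = subst₂ _≤_ (sym (k∸n∸2≡ t)) (sym (3n∸k∸1≡ t j n₁≡t+j))
    (m+n≤o⇒m≤o (suc t) (≤-reflexive (e t j)))
    where e : ∀ t j → suc t + (2 * j + 1) ≡ 2 * j + t + 2
          e = solve-∀

  B-floor : ℕ → ℕ
  B-floor t = ((suc n₁ ∸ t) * (suc n₁ ∸ t) + 1) / P

  B-mid-step : ∀ t j → n₁ ≡ t + j → 𝟙 (B-mid n (n + 3 + t)) + B-floor (suc t) ≡ B-floor t
  B-mid-step t j refl = +-cancelʳ-≡ (t + 2) _ _ (begin
    𝟙 (B-mid n k) + B-floor (suc t) + (t + 2)     ≡⟨ +-assoc (𝟙 (B-mid n k)) _ _ ⟩
    𝟙 (B-mid n k) + (B-floor (suc t) + (t + 2))   ≡⟨ cong (λ z → 𝟙 (B-mid n k) + ((z * z + 1) / P + (t + 2))) (m+n∸m≡n t j) ⟩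
    𝟙 (B-mid n k) + ((j * j + 1) / P + (t + 2))   ≡⟨ cong (𝟙 (B-mid n k) +_) ([m+kP]/P≡m/P+k {P} (j * j + 1) (t + 2)) ⟨
    𝟙 (B-mid n k) + (j * j + 1 + (t + 2) * P) / P ≡⟨ 𝟙-between-borrow M≡x+s M≡y+c (B-lower≤B-upper t j refl) c≤P ⟩
    (suc j * suc j + 1 + (t + 2) * P) / P         ≡⟨ [m+kP]/P≡m/P+k {P} (suc j * suc j + 1) (t + 2) ⟩
    (suc j * suc j + 1) / P + (t + 2)             ≡⟨ cong (λ z → (z * z + 1) / P + (t + 2)) 1+t+j∸t≡1+j ⟨
    B-floor t + (t + 2)                           ∎)
    where
    open ≡-Reasoning
    k = n + 3 + t
    1+t+j∸t≡1+j : suc (t + j) ∸ t ≡ suc j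
    1+t+j∸t≡1+j = trans (cong (_∸ t) (sym (+-suc t j))) (m+n∸m≡n t (suc j))
    M≡x+s : (k ∸ 1) * (k ∸ 1) ≡ suc j * suc j + 1 + (t + 2) * P + (k ∸ n ∸ 2)
    M≡x+s = begin
      (k ∸ 1) * (k ∸ 1)                                        ≡⟨ cong (λ z → z * z) (k∸1≡ t) ⟩
      (n + 2 + t) * (n + 2 + t)                                ≡⟨ e t j ⟩
      suc j * suc j + 1 + (t + 2) * (11 + (t + j) * 4) + suc t ≡⟨ cong₂ (λ P′ s → suc j * suc j + 1 + (t + 2) * P′ + s) (sym P≡11+n₁*4) (sym (k∸n∸2≡ t)) ⟩
      suc j * suc j + 1 + (t + 2) * P + (k ∸ n ∸ 2)            ∎
      where e : ∀ t j → (3 + (t + j) + 2 + t) * (3 + (t + j) + 2 + t) ≡ suc j * suc j + 1 + (t + 2) * (11 + (t + j) * 4) + suc t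
            e = solve-∀
    M≡y+c : (k ∸ 1) * (k ∸ 1) ≡ j * j + 1 + (t + 2) * P + (3 * n ∸ k ∸ 1)
    M≡y+c = begin
      (k ∸ 1) * (k ∸ 1)                                                ≡⟨ cong (λ z → z * z) (k∸1≡ t) ⟩
      (n + 2 + t) * (n + 2 + t)                                        ≡⟨ e t j ⟩
      j * j + 1 + (t + 2) * (11 + (t + j) * 4) + (2 * j + t + 2)       ≡⟨ cong₂ (λ P′ c → j * j + 1 + (t + 2) * P′ + c) (sym P≡11+n₁*4) (sym (3n∸k∸1≡ t j refl)) ⟩
      j * j + 1 + (t + 2) * P + (3 * n ∸ k ∸ 1)                        ∎
      where e : ∀ t j → (3 + (t + j) + 2 + t) * (3 + (t + j) + 2 + t) ≡ j * j + 1 + (t + 2) * (11 + (t + j) * 4) + (2 * j + t + 2)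
            e = solve-∀
    c≤P : 3 * n ∸ k ∸ 1 ≤ P
    c≤P = subst₂ _≤_ (sym (3n∸k∸1≡ t j refl)) (sym P≡11+n₁*4) (m+n≤o⇒m≤o (2 * j + t + 2) (≤-reflexive (e t j)))
      where e : ∀ t j → 2 * j + t + 2 + (9 + 3 * t + 2 * j) ≡ 11 + (t + j) * 4
            e = solve-∀

  B-trichotomy : ∀ t j → n₁ ≡ t + j → 𝟙 (B-lt n (n + 3 + t)) + 𝟙 (B-mid n (n + 3 + t)) + 𝟙 (B-ge n (n + 3 + t)) ≡ 1
  B-trichotomy t j n₁≡t+j = 𝟙-trichotomy {ρ = r n (n + 3 + t)} (B-lower≤B-upper t j n₁≡t+j)

  A-ge≡B-lt : ∀ a t → n₁ ≡ a + t → 𝟙 (A-ge n (2 + a)) ≡ 𝟙 (B-lt n (n + 3 + t))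
  A-ge≡B-lt a t refl = begin
    𝟙 (c ≤? suc a * suc a % P)  ≡⟨ cong (λ ρ → 𝟙 (c ≤? ρ)) ([m+kn]%n≡m%n (suc a * suc a) (t + 2) P) ⟨
    𝟙 (c ≤? x % P)              ≡⟨ 𝟙-≥-shift {M = M} {x} (A-upper+ {a} (x∙yz≈y∙xz a 3 t)) M≡x+2+t
                                     (∤m+n⇒∤m+kP+n {x = suc a * suc a} (t + 2) (P∤x²+1 (suc a)))
                                     (∤m+n⇒∤m+kP+n {x = suc a * suc a} (t + 2) (P∤[1+a]²+b {a} (x∙yz≈y∙xz a 3 t))) ⟩
    𝟙 (M % P <? suc t)          ≡⟨ cong (λ s → 𝟙 (M % P <? s)) (k∸n∸2≡ t) ⟨
    𝟙 (B-lt n k)                ∎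
    where
    open ≡-Reasoning
    c = 3 * n + (2 + a) ∸ 3
    k = n + 3 + t
    x = suc a * suc a + (t + 2) * P
    M = (k ∸ 1) * (k ∸ 1)
    M≡x+2+t : M ≡ x + suc (suc t)
    M≡x+2+t = begin
      (k ∸ 1) * (k ∸ 1)                                         ≡⟨ cong (λ z → z * z) (k∸1≡ t) ⟩
      (n + 2 + t) * (n + 2 + t)                                 ≡⟨ e a t ⟩
      suc a * suc a + (t + 2) * (11 + (a + t) * 4) + (2 + t)    ≡⟨ cong (λ P′ → suc a * suc a + (t + 2) * P′ + (2 + t)) P≡11+n₁*4 ⟨
      x + suc (suc t)                                           ∎
      where e : ∀ a t → (3 + (a + t) + 2 + t) * (3 + (a + t) + 2 + t) ≡ suc a * suc a + (t + 2) * (11 + (a + t) * 4) + (2 + t)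
            e = solve-∀

  count-A : ∀ {Q : Pred ℕ 0ℓ} (Q? : Decidable Q) → count 2 (n + 2) Q? ≡ ∑[ a < suc n ] 𝟙 (Q? (2 + a))
  count-A Q? = trans (count≡∑ Q? 2 (n + 2)) (cong (λ m → ∑[ a < m ] 𝟙 (Q? (2 + a))) (m+n∸n≡m (suc n) 2))

  count-B : ∀ {Q : Pred ℕ 0ℓ} (Q? : Decidable Q) → count (n + 3) (2 * n) Q? ≡ ∑[ t < suc n₁ ] 𝟙 (Q? (n + 3 + t))
  count-B Q? = trans (count≡∑ Q? (n + 3) (2 * n)) (cong (λ m → ∑[ t < m ] 𝟙 (Q? (n + 3 + t))) (m≡o+n⇒m∸n≡o {n = n + 3} (e n₁)))
    where e : ∀ n₁ → suc (2 * (3 + n₁)) ≡ suc n₁ + (3 + n₁ + 3)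
          e = solve-∀

  -- (n - 2)² + 1, the numerator in the statement.
  V : ℕ
  V = suc n₁ * suc n₁ + 1

  n²+5∸4n≡V : n * n + 5 ∸ 4 * n ≡ V
  n²+5∸4n≡V = m≡o+n⇒m∸n≡o (e n₁)
    where e : ∀ n₁ → (3 + n₁) * (3 + n₁) + 5 ≡ suc n₁ * suc n₁ + 1 + 4 * (3 + n₁)
          e = solve-∀

  #A-mid : count 2 (n + 2) (A-mid n) ≡ V / P + 2
  #A-mid = begin
    count 2 (n + 2) (A-mid n)  ≡⟨ count-A (A-mid n) ⟩
    S                          ≡⟨ +-identityʳ S ⟨
    S + 0                      ≡⟨ cong (S +_) A-floor0≡0 ⟨
    S + A-floor 0              ≡⟨ ∑-telescope-up (suc n) {F = A-floor} (λ a u e → A-mid-step {a} (suc-injective e)) ⟩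
    A-floor (suc n)            ≡⟨ cong (_/ P) (trans (e n₁) (cong (λ P′ → V + 2 * P′) (sym P≡11+n₁*4))) ⟩
    (V + 2 * P) / P            ≡⟨ [m+kP]/P≡m/P+k {P} V 2 ⟩
    V / P + 2                  ∎
    where
    open ≡-Reasoning
    S = ∑[ a < suc n ] 𝟙 (A-mid n (2 + a))
    A-floor0≡0 : A-floor 0 ≡ 0
    A-floor0≡0 = m<n⇒m/n≡0 (subst (suc (n + 1) ≤_) (sym P≡11+n₁*4) (m+n≤o⇒m≤o (suc (n + 1)) (≤-reflexive (e₀ n₁))))
      where e₀ : ∀ n₁ → suc (3 + n₁ + 1) + (6 + 3 * n₁) ≡ 11 + n₁ * 4
            e₀ = solve-∀
    e : ∀ n₁ → suc (3 + n₁) * suc (3 + n₁) + suc (3 + n₁) + (3 + n₁) + 1 ≡ suc n₁ * suc n₁ + 1 + 2 * (11 + n₁ * 4)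
    e = solve-∀

  #B-mid : count (n + 3) (2 * n) (B-mid n) ≡ V / P
  #B-mid = begin
    count (n + 3) (2 * n) (B-mid n)  ≡⟨ count-B (B-mid n) ⟩
    S                                ≡⟨ +-identityʳ S ⟨
    S + 0                            ≡⟨ cong (S +_) B-floor[1+n₁]≡0 ⟨
    S + B-floor (suc n₁)             ≡⟨ ∑-telescope-down (suc n₁) {F = B-floor} (λ t j e → B-mid-step t j (sym (suc-injective e))) ⟩
    V / P                            ∎
    where
    open ≡-Reasoning
    S = ∑[ t < suc n₁ ] 𝟙 (B-mid n (n + 3 + t))
    B-floor[1+n₁]≡0 : B-floor (suc n₁) ≡ 0
    B-floor[1+n₁]≡0 = trans (cong (λ z → (z * z + 1) / P) (n∸n≡0 n₁)) (m<n⇒m/n≡0 {n = P} (s≤s (s≤s z≤n)))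

  #A-ge≡#B-lt : count 2 (n + 2) (A-ge n) ≡ count (n + 3) (2 * n) (B-lt n)
  #A-ge≡#B-lt = begin
    count 2 (n + 2) (A-ge n)                                 ≡⟨ count-A (A-ge n) ⟩
    ∑[ a < suc n ] 𝟙 (A-ge n (2 + a))                        ≡⟨ cong (λ m → ∑[ a < m ] 𝟙 (A-ge n (2 + a))) (+-comm (suc n₁) 3) ⟨
    ∑[ a < suc n₁ + 3 ] 𝟙 (A-ge n (2 + a))                   ≡⟨ ∑-+ (suc n₁) 3 (λ a → 𝟙 (A-ge n (2 + a))) ⟩
    ∑[ a < suc n₁ ] 𝟙 (A-ge n (2 + a)) + ∑[ i < 3 ] 𝟙 (A-ge n (2 + (suc n₁ + i)))
      ≡⟨ cong₂ _+_ (∑-reverse (suc n₁) (λ a t e → A-ge≡B-lt a t (sym (suc-injective e))))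
                   (∑-zero 3 (λ i j e → A-ge-top {suc n₁ + i} (top i j e) (j≤2 i j e))) ⟩
    ∑[ t < suc n₁ ] 𝟙 (B-lt n (n + 3 + t)) + 0              ≡⟨ +-identityʳ _ ⟩
    ∑[ t < suc n₁ ] 𝟙 (B-lt n (n + 3 + t))                  ≡⟨ count-B (B-lt n) ⟨
    count (n + 3) (2 * n) (B-lt n)                           ∎
    where
    open ≡-Reasoning
    top : ∀ i j → suc (i + j) ≡ 3 → suc n₁ + i + j ≡ n
    top i j e = trans (+-assoc (suc n₁) i j) (trans (cong (suc n₁ +_) (suc-injective e)) (+-comm (suc n₁) 2))
    j≤2 : ∀ i j → suc (i + j) ≡ 3 → j ≤ 2
    j≤2 i j e = subst (j ≤_) (suc-injective e) (m≤n+m j i)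

  #A : count 2 (n + 2) (A-lt n) + count 2 (n + 2) (A-mid n) + count 2 (n + 2) (A-ge n) ≡ 3 + suc n₁
  #A = trans (cong₂ _+_ (cong₂ _+_ (count-A (A-lt n)) (count-A (A-mid n))) (count-A (A-ge n)))
             (∑-partition (suc n) (λ a → 𝟙 (A-lt n (2 + a))) (λ a → 𝟙 (A-mid n (2 + a))) (λ a → 𝟙 (A-ge n (2 + a)))
               (λ a u e → A-trichotomy {a} (suc-injective e)))

  #B : count (n + 3) (2 * n) (B-lt n) + count (n + 3) (2 * n) (B-mid n) + count (n + 3) (2 * n) (B-ge n) ≡ suc n₁
  #B = trans (cong₂ _+_ (cong₂ _+_ (count-B (B-lt n)) (count-B (B-mid n))) (count-B (B-ge n)))
             (∑-partition (suc n₁) (λ t → 𝟙 (B-lt n (n + 3 + t))) (λ t → 𝟙 (B-mid n (n + 3 + t))) (λ t → 𝟙 (B-ge n (n + 3 + t)))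
               (λ t j e → B-trichotomy t j (sym (suc-injective e))))

corollary4p5 : (n : ℕ) → 3 < n → Prime (p n) →
    (count (n + 3) (2 * n) (B-mid n) ≡ (n * n + 5 ∸ 4 * n) / p n)
    × (count 2 (n + 2) (A-ge n) ≡ count (n + 3) (2 * n) (B-lt n))
    × (count 2 (n + 2) (A-mid n) ≡ count (n + 3) (2 * n) (B-mid n) + 2)
    × (count 2 (n + 2) (A-lt n) ≡ count (n + 3) (2 * n) (B-ge n) + 1)
corollary4p5 (suc (suc (suc (suc n₀)))) (s≤s (s≤s (s≤s (s≤s z≤n)))) _ =
    trans #B-mid (cong (_/ P) (sym n²+5∸4n≡V))
  , #A-ge≡#B-lt
  , #A-mid≡#B-mid+2
  , missing-summand #A #B #A-mid≡#B-mid+2 #A-ge≡#B-lt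
  where
  open Counting (suc n₀)
  #A-mid≡#B-mid+2 : count 2 (n + 2) (A-mid n) ≡ count (n + 3) (2 * n) (B-mid n) + 2
  #A-mid≡#B-mid+2 = trans #A-mid (cong (_+ 2) (sym #B-mid))
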